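{- Let $b\ge2$ and let $U^1,\dots,U^b$ be tree topologies on disjoint node sets. Let $U$ be the tree obtained from their disjoint union by adding a new node $r$ and connecting $r$ by an edge to one node of each $U^i$. Then for every choice of vertices $P^1,\dots,P^b$, where $P^i$ is a vertex of the polyhedron of the STT LP for $U^i$, there is a vertex $P$ of the polyhedron of the STT LP for $U$ whose projection onto the variables related only to $U^i$ (the variables $X_{uv}$ and $Z_{kuv}$ with $u,v,k\in U^i$) equals the corresponding coordinates of $P^i$, for every $i$.
   Context: For a tree $U$ and distinct nodes $i,j$, $(i\leftrightsquigarrow j)$ denotes the nodes strictly between $i$ and $j$ on the $U$-path. The STT LP for $U$ has variables $D_i$ ($i\in U$), $X_{ij}$ ($i\ne j$), $Z_{kij}=Z_{kji}$ ($k\in(i\leftrightsquigarrow j)$); constraints $X_{ij}\ge0$, $Z_{kij}\ge0$; for all $i\ne j$: $X_{ij}+X_{ji}+\sum_{k\in(i\leftrightsquigarrow j)}Z_{kij}\ge1$; $Z_{kij}\le X_{ki}$, $Z_{kij}\le X_{kj}$; $D_i\ge\sum_{j\ne i}X_{ji}$.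
   Formalization: The points of the STT polyhedra, namely the vertices $P^i$ and $P$ and the points against which extremality is tested, have rational coordinates instead of real ones. -}

module Defs where

open import Level using (0ℓ)
open import Data.Nat using (ℕ; _≥_)
open import Data.Fin using (Fin)
open import Data.Maybe using (Maybe; just; nothing)
open import Data.Product using (Σ; ∃; _×_; _,_)
open import Data.List using (List; []; _∷_; map; concatMap; foldr; allFin)
open import Data.List.Membership.Propositional using (_∈_)
open import Data.List.Relation.Unary.Unique.Propositional using (Unique)
open import Data.Rational using (ℚ; 0ℚ; 1ℚ; ½; _+_; _*_; _≤_)
open import Relation.Binary.PropositionalEquality using (_≡_; _≢_)
open import Relation.Nullary using (¬_)

data Walk {V : Set} (E : V → V → Set) : V → V → List V → Set where
  here : ∀ {u} → Walk E u u (u ∷ [])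
  step : ∀ {u w v vs} → E u w → Walk E w v vs → Walk E u v (u ∷ vs)

SimplePath : {V : Set} → (V → V → Set) → V → V → List V → Set
SimplePath E u v vs = Walk E u v vs × Unique vs

record IsTree {V : Set} (E : V → V → Set) : Set where
  field
    sym    : ∀ {u v} → E u v → E v u
    irrefl : ∀ u → ¬ E u u
    path   : ∀ u v → ∃ λ vs → SimplePath E u v vs
    unique : ∀ u v vs ws → SimplePath E u v vs → SimplePath E u v ws → vs ≡ ws

Between : {V : Set} → (V → V → Set) → V → V → V → Set
Between E i j k = ∃ λ vs → SimplePath E i j vs × k ∈ vs × k ≢ i × k ≢ j

sumℚ : {V : Set} → List V → (V → ℚ) → ℚ
sumℚ enum f = foldr (λ v acc → f v + acc) 0ℚ enum

-- Coordinates X i i and Z k i j with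
-- k ∉ (i ⇝ j) are dummy coordinates, forced to 0 by the polyhedron;
-- Z k i j and Z k j i are identified by an equality constraint.
record Point (V : Set) : Set where
  constructor point
  field
    D : V → ℚ
    X : V → V → ℚ
    Z : V → V → V → ℚ
open Point public

-- Membership in the STT polyhedron of the tree with adjacency E,
-- whose (finite) node set is enumerated (without repetition) by enum.
record InSTT {V : Set} (E : V → V → Set) (enum : List V) (p : Point V) : Set where
  field
    X-diag  : ∀ i → X p i i ≡ 0ℚ
    Z-dummy : ∀ k i j → ¬ Between E i j k → Z p k i j ≡ 0ℚ
    Z-sym   : ∀ k i j → Z p k i j ≡ Z p k j i
    X-nonneg : ∀ i j → i ≢ j → 0ℚ ≤ X p i j
    Z-nonneg : ∀ k i j → Between E i j k → 0ℚ ≤ Z p k i j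
    cover   : ∀ i j → i ≢ j →
              1ℚ ≤ X p i j + X p j i + sumℚ enum (λ k → Z p k i j)
    Z≤Xi    : ∀ k i j → Between E i j k → Z p k i j ≤ X p k i
    Z≤Xj    : ∀ k i j → Between E i j k → Z p k i j ≤ X p k j
    D-bound : ∀ i → sumℚ enum (λ j → X p j i) ≤ D p i

Midpoint : {V : Set} → Point V → Point V → Point V → Set
Midpoint p q r =
  (∀ i → D p i ≡ ½ * (D q i + D r i)) ×
  (∀ i j → X p i j ≡ ½ * (X q i j + X r i j)) ×
  (∀ k i j → Z p k i j ≡ ½ * (Z q k i j + Z r k i j))

SamePoint : {V : Set} → Point V → Point V → Set
SamePoint q r =
  (∀ i → D q i ≡ D r i) × (∀ i j → X q i j ≡ X r i j) ×
  (∀ k i j → Z q k i j ≡ Z r k i j)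

IsVertex : {V : Set} → (V → V → Set) → List V → Point V → Set
IsVertex E enum p =
  InSTT E enum p ×
  (∀ q r → InSTT E enum q → InSTT E enum r → Midpoint p q r → SamePoint q r)

-- Gluing b trees U^i (on node sets Fin (n i)) at a new node r (= nothing),
-- r adjacent to the node c i of each U^i.

GNode : (b : ℕ) → (n : Fin b → ℕ) → Set
GNode b n = Maybe (Σ (Fin b) (λ i → Fin (n i)))

data GEdge (b : ℕ) (n : Fin b → ℕ)
           (E : (i : Fin b) → Fin (n i) → Fin (n i) → Set)
           (c : (i : Fin b) → Fin (n i)) : GNode b n → GNode b n → Set where
  inside : ∀ {i u v} → E i u v → GEdge b n E c (just (i , u)) (just (i , v))
  down   : ∀ i → GEdge b n E c nothing (just (i , c i))
  up     : ∀ i → GEdge b n E c (just (i , c i)) nothing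

genum : (b : ℕ) → (n : Fin b → ℕ) → List (GNode b n)
genum b n = nothing ∷ concatMap (λ i → map (λ u → just (i , u)) (allFin (n i))) (allFin b)

module Submission where

-- Copy P^i inside each U^i, put X_{r x} = 1 for every node x ≠ r and
-- X_{u v} = 1 for u ∈ U^i, v ∈ U^j with i < j (r above everything, subtrees
-- stacked in a fixed order), set every other X and Z to 0 and every D to its
-- column sum.  If it is the midpoint of two feasible
-- points q and s, then restricting q and s to U^i (with D shifted by half the
-- difference of their column sums) writes P^i as a midpoint, so q and s agree
-- inside every subtree.  Every other X or Z coordinate of the glued point is
-- 0, or is 1 with its reverse X and all its Z equal to 0; the first kind is
-- pinned by nonnegativity, the second by the covering constraint.  Finally
-- the D coordinates are pinned because the glued D is tight.

open import Defs
open import Data.Nat using (ℕ; _≥_)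
import Data.Nat.Properties as ℕ
open import Data.Fin using (Fin; zero; suc)
import Data.Fin.Properties as Fin
open import Data.Maybe using (just; nothing)
open import Data.Product using (∃; _×_; _,_; proj₁; proj₂)
open import Data.Sum using (_⊎_; inj₁; inj₂)
open import Data.List using (List; []; _∷_; map; concatMap; allFin; _++_)
open import Data.List.Properties using (map-tabulate)
open import Data.List.Membership.Propositional.Properties using (∈-map⁺)
open import Data.List.Relation.Unary.Unique.Propositional.Properties using (map⁺)
open import Data.Rational using (ℚ; 0ℚ; 1ℚ; ½; _+_; _*_; _≤_; -_)
open import Data.Rational.Properties
open import Data.Rational.Solver using (module +-*-Solver)
open import Relation.Binary.PropositionalEquality
open import Relation.Nullary using (¬_; Dec; yes; no)
open import Relation.Nullary.Decidable using (decidable-stable)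
open import Data.Empty using (⊥-elim)

open +-*-Solver

both-≡⇒≡ : ∀ {A : Set} {a b c : A} → a ≡ c × b ≡ c → a ≡ b
both-≡⇒≡ (a≡c , b≡c) = trans a≡c (sym b≡c)

midpoint-lowerBound⇒≡ˡ : ∀ {a b c} → c ≤ a → c ≤ b → c ≡ ½ * (a + b) → a ≡ c
midpoint-lowerBound⇒≡ˡ {a} {b} m≤a m≤b refl = ≤-antisym a≤m m≤a
  where
  open ≤-Reasoning
  a≤m : a ≤ ½ * (a + b)
  a≤m = begin
    a                                   ≡⟨ solve 2 (λ a b → a := a :+ con ½ :* (a :+ b) :+ :- (con ½ :* (a :+ b))) refl a b ⟩
    a + ½ * (a + b) + - (½ * (a + b))   ≤⟨ +-monoˡ-≤ (- (½ * (a + b))) (+-monoʳ-≤ a m≤b) ⟩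
    a + b + - (½ * (a + b))             ≡⟨ solve 2 (λ a b → a :+ b :+ :- (con ½ :* (a :+ b)) := con ½ :* (a :+ b)) refl a b ⟩
    ½ * (a + b)                         ∎

midpoint-lowerBound⇒≡ : ∀ {a b c} → c ≤ a → c ≤ b → c ≡ ½ * (a + b) → a ≡ c × b ≡ c
midpoint-lowerBound⇒≡ {a} {b} c≤a c≤b c≡ =
  midpoint-lowerBound⇒≡ˡ c≤a c≤b c≡ ,
  midpoint-lowerBound⇒≡ˡ c≤b c≤a (trans c≡ (cong (½ *_) (+-comm a b)))

-- ≤ on ℚ is decidable, so it is stable under the double negation that a case
-- split on an undecidable P costs.
≤-byCases : ∀ {P : Set} {p q} → (P → p ≤ q) → (¬ P → p ≤ q) → p ≤ q
≤-byCases {p = p} {q} yesP noP = decidable-stable (p ≤? q) λ p≰q → p≰q (noP (λ x → p≰q (yesP x)))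

module _ {V : Set} where

  sumℚ-cong : ∀ (l : List V) {f g : V → ℚ} → (∀ x → f x ≡ g x) → sumℚ l f ≡ sumℚ l g
  sumℚ-cong []      f≡g = refl
  sumℚ-cong (x ∷ l) f≡g = cong₂ _+_ (f≡g x) (sumℚ-cong l f≡g)

  sumℚ-zero : ∀ (l : List V) {f : V → ℚ} → (∀ x → f x ≡ 0ℚ) → sumℚ l f ≡ 0ℚ
  sumℚ-zero []      f≡0 = refl
  sumℚ-zero (x ∷ l) f≡0 = trans (cong₂ _+_ (f≡0 x) (sumℚ-zero l f≡0)) (+-identityˡ 0ℚ)

  sumℚ-nonneg : ∀ (l : List V) {f : V → ℚ} → (∀ x → 0ℚ ≤ f x) → 0ℚ ≤ sumℚ l f
  sumℚ-nonneg []      f≥0 = ≤-refl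
  sumℚ-nonneg (x ∷ l) {f} f≥0 = subst (_≤ f x + sumℚ l f) (+-identityˡ 0ℚ) (+-mono-≤ (f≥0 x) (sumℚ-nonneg l f≥0))

  sumℚ-linear : ∀ (l : List V) h (f g : V → ℚ) →
                sumℚ l (λ x → h * (f x + g x)) ≡ h * (sumℚ l f + sumℚ l g)
  sumℚ-linear []      h f g = solve 1 (λ h → con 0ℚ := h :* (con 0ℚ :+ con 0ℚ)) refl h
  sumℚ-linear (x ∷ l) h f g = begin
    h * (f x + g x) + sumℚ l (λ y → h * (f y + g y))  ≡⟨ cong (h * (f x + g x) +_) (sumℚ-linear l h f g) ⟩
    h * (f x + g x) + h * (sumℚ l f + sumℚ l g)        ≡⟨ solve 5 (λ h a b A B → h :* (a :+ b) :+ h :* (A :+ B) := h :* ((a :+ A) :+ (b :+ B))) refl h (f x) (g x) (sumℚ l f) (sumℚ l g) ⟩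
    h * (sumℚ (x ∷ l) f + sumℚ (x ∷ l) g)              ∎
    where open ≡-Reasoning

  sumℚ-++ : ∀ (xs ys : List V) f → sumℚ (xs ++ ys) f ≡ sumℚ xs f + sumℚ ys f
  sumℚ-++ []       ys f = sym (+-identityˡ _)
  sumℚ-++ (x ∷ xs) ys f = trans (cong (f x +_) (sumℚ-++ xs ys f)) (sym (+-assoc (f x) _ _))

  sumℚ-map : ∀ {A : Set} (h : A → V) xs f → sumℚ (map h xs) f ≡ sumℚ xs (λ x → f (h x))
  sumℚ-map h []       f = refl
  sumℚ-map h (x ∷ xs) f = cong (f (h x) +_) (sumℚ-map h xs f)

  sumℚ-concatMap : ∀ {A : Set} (g : A → List V) xs f →
                   sumℚ (concatMap g xs) f ≡ sumℚ xs (λ a → sumℚ (g a) f)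
  sumℚ-concatMap g []       f = refl
  sumℚ-concatMap g (x ∷ xs) f =
    trans (sumℚ-++ (g x) (concatMap g xs) f) (cong (sumℚ (g x) f +_) (sumℚ-concatMap g xs f))

sumℚ-allFin-suc : ∀ m (f : Fin (ℕ.suc m) → ℚ) →
                  sumℚ (allFin (ℕ.suc m)) f ≡ f zero + sumℚ (allFin m) (λ j → f (suc j))
sumℚ-allFin-suc m f =
  cong (f zero +_) (trans (cong (λ l → sumℚ l f) (sym (map-tabulate (λ j → j) suc))) (sumℚ-map suc (allFin m) f))

sumℚ-allFin-single : ∀ m (f : Fin m → ℚ) i → (∀ j → j ≢ i → f j ≡ 0ℚ) → sumℚ (allFin m) f ≡ f i
sumℚ-allFin-single (ℕ.suc m) f zero f≡0 = begin
  sumℚ (allFin (ℕ.suc m)) f                   ≡⟨ sumℚ-allFin-suc m f ⟩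
  f zero + sumℚ (allFin m) (λ j → f (suc j))  ≡⟨ cong (f zero +_) (sumℚ-zero (allFin m) (λ j → f≡0 (suc j) (λ ()))) ⟩
  f zero + 0ℚ                                 ≡⟨ +-identityʳ _ ⟩
  f zero                                      ∎
  where open ≡-Reasoning
sumℚ-allFin-single (ℕ.suc m) f (suc i) f≡0 = begin
  sumℚ (allFin (ℕ.suc m)) f                   ≡⟨ sumℚ-allFin-suc m f ⟩
  f zero + sumℚ (allFin m) (λ j → f (suc j))  ≡⟨ cong₂ _+_ (f≡0 zero (λ ())) rest ⟩
  0ℚ + f (suc i)                              ≡⟨ +-identityˡ _ ⟩
  f (suc i)                                   ∎
  where
  open ≡-Reasoning
  rest = sumℚ-allFin-single m (λ j → f (suc j)) i (λ j j≢i → f≡0 (suc j) (λ eq → j≢i (Fin.suc-injective eq)))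

sumℚ-genum-subtree : ∀ {b} {n : Fin b → ℕ} i (f : GNode b n → ℚ) → f nothing ≡ 0ℚ →
                     (∀ j u → j ≢ i → f (just (j , u)) ≡ 0ℚ) →
                     sumℚ (genum b n) f ≡ sumℚ (allFin (n i)) (λ u → f (just (i , u)))
sumℚ-genum-subtree {b} {n} i f f-root f-other = begin
  f nothing + sumℚ (concatMap subtree (allFin b)) f   ≡⟨ cong₂ _+_ f-root (sumℚ-concatMap subtree (allFin b) f) ⟩
  0ℚ + sumℚ (allFin b) (λ j → sumℚ (subtree j) f)     ≡⟨ +-identityˡ _ ⟩
  sumℚ (allFin b) (λ j → sumℚ (subtree j) f)          ≡⟨ sumℚ-allFin-single b _ i other-subtrees ⟩
  sumℚ (subtree i) f                                  ≡⟨ sumℚ-map (λ u → just (i , u)) (allFin (n i)) f ⟩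
  sumℚ (allFin (n i)) (λ u → f (just (i , u)))        ∎
  where
  open ≡-Reasoning
  subtree : (j : Fin b) → List (GNode b n)
  subtree j = map (λ u → just (j , u)) (allFin (n j))
  other-subtrees : ∀ j → j ≢ i → sumℚ (subtree j) f ≡ 0ℚ
  other-subtrees j j≢i =
    trans (sumℚ-map (λ u → just (j , u)) (allFin (n j)) f) (sumℚ-zero (allFin (n j)) (λ u → f-other j u j≢i))

module _ {V W : Set} {E : V → V → Set} {F : W → W → Set}
         (f : V → W) (f-hom : ∀ {u v} → E u v → F (f u) (f v)) where

  Walk-map : ∀ {u v vs} → Walk E u v vs → Walk F (f u) (f v) (map f vs)
  Walk-map here       = here
  Walk-map (step e w) = step (f-hom e) (Walk-map w)

  Between-map : (∀ {u v} → f u ≡ f v → u ≡ v) → ∀ {u v k} → Between E u v k → Between F (f u) (f v) (f k)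
  Between-map f-inj (vs , (walk , unique) , k∈vs , k≢u , k≢v) =
    map f vs , (Walk-map walk , map⁺ f-inj unique) , ∈-map⁺ f k∈vs , (λ eq → k≢u (f-inj eq)) , (λ eq → k≢v (f-inj eq))

module InSTT-Properties {V : Set} {E : V → V → Set} {enum : List V} {p : Point V}
                      (p∈ : InSTT E enum p) where
  open InSTT p∈

  X≥0 : ∀ x y → 0ℚ ≤ X p x y
  X≥0 x y = ≤-byCases {P = x ≡ y} (λ { refl → ≤-reflexive (sym (X-diag x)) }) (X-nonneg x y)

  Z≥0 : ∀ k x y → 0ℚ ≤ Z p k x y
  Z≥0 k x y = ≤-byCases (Z-nonneg k x y) (λ k∉ → ≤-reflexive (sym (Z-dummy k x y k∉)))

  Z≤Xᵢ : ∀ k x y → Z p k x y ≤ X p k x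
  Z≤Xᵢ k x y = ≤-byCases (Z≤Xi k x y) (λ k∉ → subst (_≤ X p k x) (sym (Z-dummy k x y k∉)) (X≥0 k x))

  Z≤Xⱼ : ∀ k x y → Z p k x y ≤ X p k y
  Z≤Xⱼ k x y = ≤-byCases (Z≤Xj k x y) (λ k∉ → subst (_≤ X p k y) (sym (Z-dummy k x y k∉)) (X≥0 k y))

  cover-forces-X : ∀ {x y} → x ≢ y → X p y x ≡ 0ℚ → (∀ k → Z p k x y ≡ 0ℚ) → 1ℚ ≤ X p x y
  cover-forces-X {x} {y} x≢y yx≡0 Z≡0 = subst (1ℚ ≤_) cover-sum≡X (cover x y x≢y)
    where
    open ≡-Reasoning
    cover-sum≡X : X p x y + X p y x + sumℚ enum (λ k → Z p k x y) ≡ X p x y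
    cover-sum≡X = begin
      X p x y + X p y x + sumℚ enum (λ k → Z p k x y)  ≡⟨ cong₂ (λ a t → X p x y + a + t) yx≡0 (sumℚ-zero enum Z≡0) ⟩
      X p x y + 0ℚ + 0ℚ                                 ≡⟨ solve 1 (λ a → a :+ con 0ℚ :+ con 0ℚ := a) refl (X p x y) ⟩
      X p x y                                           ∎

Midpoint-swap : ∀ {V : Set} {m q s : Point V} → Midpoint m q s → Midpoint m s q
Midpoint-swap {q = q} {s} (D-mid , X-mid , Z-mid) =
  (λ i → trans (D-mid i) (cong (½ *_) (+-comm (D q i) (D s i)))) ,
  (λ i j → trans (X-mid i j) (cong (½ *_) (+-comm (X q i j) (X s i j)))) ,
  (λ k i j → trans (Z-mid k i j) (cong (½ *_) (+-comm (Z q k i j) (Z s k i j))))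

module Midpoint-Properties {V : Set} {E : V → V → Set} {enum : List V} {m q s : Point V}
                           (q∈ : InSTT E enum q) (s∈ : InSTT E enum s) (mid : Midpoint m q s) where
  private
    module Q = InSTT-Properties q∈
    module S = InSTT-Properties s∈
    D-mid = proj₁ mid
    X-mid = proj₁ (proj₂ mid)
    Z-mid = proj₂ (proj₂ mid)

  X-zero : ∀ {x y} → X m x y ≡ 0ℚ → X q x y ≡ 0ℚ × X s x y ≡ 0ℚ
  X-zero {x} {y} m≡0 = midpoint-lowerBound⇒≡ (Q.X≥0 x y) (S.X≥0 x y) (trans (sym m≡0) (X-mid x y))

  Z-zero : ∀ {k x y} → Z m k x y ≡ 0ℚ → Z q k x y ≡ 0ℚ × Z s k x y ≡ 0ℚ
  Z-zero {k} {x} {y} m≡0 = midpoint-lowerBound⇒≡ (Q.Z≥0 k x y) (S.Z≥0 k x y) (trans (sym m≡0) (Z-mid k x y))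

  X-one : ∀ {x y} → x ≢ y → X m x y ≡ 1ℚ → X m y x ≡ 0ℚ → (∀ k → Z m k x y ≡ 0ℚ) →
          X q x y ≡ 1ℚ × X s x y ≡ 1ℚ
  X-one {x} {y} x≢y m≡1 m-rev≡0 Zm≡0 =
    midpoint-lowerBound⇒≡
      (Q.cover-forces-X x≢y (proj₁ (X-zero m-rev≡0)) (λ k → proj₁ (Z-zero (Zm≡0 k))))
      (S.cover-forces-X x≢y (proj₂ (X-zero m-rev≡0)) (λ k → proj₂ (Z-zero (Zm≡0 k))))
      (trans (sym m≡1) (X-mid x y))

  D-tight : ∀ x → D m x ≡ sumℚ enum (λ j → X m j x) → (∀ j → X q j x ≡ X s j x) → D q x ≡ D s x
  D-tight x tight Xq≡Xs = both-≡⇒≡ (midpoint-lowerBound⇒≡ Sq≤Dq Sq≤Ds Sq≡midpoint)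
    where
    open ≡-Reasoning
    Sq = sumℚ enum (λ j → X q j x)
    Sq≡Ss : Sq ≡ sumℚ enum (λ j → X s j x)
    Sq≡Ss = sumℚ-cong enum Xq≡Xs
    Sq≤Dq : Sq ≤ D q x
    Sq≤Dq = InSTT.D-bound q∈ x
    Sq≤Ds : Sq ≤ D s x
    Sq≤Ds = subst (_≤ D s x) (sym Sq≡Ss) (InSTT.D-bound s∈ x)
    Sq≡midpoint : Sq ≡ ½ * (D q x + D s x)
    Sq≡midpoint = begin
      Sq                                                       ≡⟨ solve 1 (λ a → a := con ½ :* (a :+ a)) refl Sq ⟩
      ½ * (Sq + Sq)                                            ≡⟨ cong (λ t → ½ * (Sq + t)) Sq≡Ss ⟩
      ½ * (Sq + sumℚ enum (λ j → X s j x))                     ≡⟨ sym (sumℚ-linear enum ½ (λ j → X q j x) (λ j → X s j x)) ⟩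
      sumℚ enum (λ j → ½ * (X q j x + X s j x))                ≡⟨ sym (sumℚ-cong enum (λ j → X-mid j x)) ⟩
      sumℚ enum (λ j → X m j x)                                ≡⟨ sym tight ⟩
      D m x                                                    ≡⟨ D-mid x ⟩
      ½ * (D q x + D s x)                                      ∎

module Gluing (b : ℕ) (n : Fin b → ℕ)
              (E : (i : Fin b) → Fin (n i) → Fin (n i) → Set)
              (c : (i : Fin b) → Fin (n i))
              (P : (i : Fin b) → Point (Fin (n i)))
              (P-vertex : ∀ i → IsVertex (E i) (allFin (n i)) (P i)) where

  Node : Set
  Node = GNode b n

  G : Node → Node → Set
  G = GEdge b n E c

  nodes : List Node
  nodes = genum b n

  ι : (i : Fin b) → Fin (n i) → Node
  ι i u = just (i , u)

  ι-injectiveˡ : ∀ {i j u v} → ι i u ≡ ι j v → i ≡ j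
  ι-injectiveˡ refl = refl

  ι-injectiveʳ : ∀ {i u v} → ι i u ≡ ι i v → u ≡ v
  ι-injectiveʳ refl = refl

  P∈ : ∀ i → InSTT (E i) (allFin (n i)) (P i)
  P∈ i = proj₁ (P-vertex i)

  precedes : Fin b → Fin b → ℚ
  precedes i j with i Fin.<? j
  ... | yes _ = 1ℚ
  ... | no  _ = 0ℚ

  precedes≥0 : ∀ i j → 0ℚ ≤ precedes i j
  precedes≥0 i j with i Fin.<? j
  ... | yes _ = nonNegative⁻¹ 1ℚ
  ... | no  _ = ≤-refl

  precedes-antisym : ∀ {i j} → i ≢ j →
                     (precedes i j ≡ 1ℚ × precedes j i ≡ 0ℚ) ⊎ (precedes i j ≡ 0ℚ × precedes j i ≡ 1ℚ)
  precedes-antisym {i} {j} i≢j with i Fin.<? j | j Fin.<? i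
  ... | yes i<j | yes j<i = ⊥-elim (Fin.<-asym i<j j<i)
  ... | yes _   | no  _   = inj₁ (refl , refl)
  ... | no  _   | yes _   = inj₂ (refl , refl)
  ... | no  i≮j | no  j≮i = ⊥-elim (i≢j (Fin.toℕ-injective (ℕ.≤-antisym (ℕ.≮⇒≥ j≮i) (ℕ.≮⇒≥ i≮j))))

  Xᵍ : Node → Node → ℚ
  Xᵍ nothing  nothing  = 0ℚ
  Xᵍ nothing  (just _) = 1ℚ
  Xᵍ (just _) nothing  = 0ℚ
  Xᵍ (just (i , u)) (just (j , v)) with i Fin.≟ j
  ... | yes refl = X (P i) u v
  ... | no  _    = precedes i j

  Zᵍ : Node → Node → Node → ℚ
  Zᵍ (just (i , k)) (just (j , u)) (just (l , v)) with i Fin.≟ j | i Fin.≟ l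
  ... | yes refl | yes refl = Z (P i) k u v
  ... | _        | _        = 0ℚ
  Zᵍ _ _ _ = 0ℚ

  Dᵍ : Node → ℚ
  Dᵍ x = sumℚ nodes (λ j → Xᵍ j x)

  glued : Point Node
  glued = point Dᵍ Xᵍ Zᵍ

  Xᵍ-inside : ∀ i u v → Xᵍ (ι i u) (ι i v) ≡ X (P i) u v
  Xᵍ-inside i u v with i Fin.≟ i
  ... | yes refl = refl
  ... | no  i≢i  = ⊥-elim (i≢i refl)

  Zᵍ-inside : ∀ i k u v → Zᵍ (ι i k) (ι i u) (ι i v) ≡ Z (P i) k u v
  Zᵍ-inside i k u v with i Fin.≟ i
  ... | yes refl = refl
  ... | no  i≢i  = ⊥-elim (i≢i refl)

  Xᵍ-across : ∀ {i j} u v → i ≢ j → Xᵍ (ι i u) (ι j v) ≡ precedes i j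
  Xᵍ-across {i} {j} u v i≢j with i Fin.≟ j
  ... | yes i≡j = ⊥-elim (i≢j i≡j)
  ... | no  _   = refl

  Zᵍ-elsewhere : ∀ {i j l} k u v → i ≢ j ⊎ i ≢ l → Zᵍ (ι i k) (ι j u) (ι l v) ≡ 0ℚ
  Zᵍ-elsewhere {i} {j} {l} k u v i≢j⊎i≢l with i Fin.≟ j | i Fin.≟ l
  Zᵍ-elsewhere k u v (inj₁ i≢i) | yes refl | yes refl = ⊥-elim (i≢i refl)
  Zᵍ-elsewhere k u v (inj₂ i≢i) | yes refl | yes refl = ⊥-elim (i≢i refl)
  ... | yes refl | no _ = refl
  ... | no _     | _    = refl

  Zᵍ-across : ∀ {i j} u v → i ≢ j → ∀ k → Zᵍ k (ι i u) (ι j v) ≡ 0ℚ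
  Zᵍ-across u v i≢j nothing        = refl
  Zᵍ-across u v i≢j (just (l , k)) = Zᵍ-elsewhere k u v (differs-from-one i≢j l)
    where
    differs-from-one : ∀ {i j} → i ≢ j → ∀ l → l ≢ i ⊎ l ≢ j
    differs-from-one {i} i≢j l with l Fin.≟ i
    ... | yes refl = inj₂ i≢j
    ... | no  l≢i  = inj₁ l≢i

  Xᵍ≥0 : ∀ x y → 0ℚ ≤ Xᵍ x y
  Xᵍ≥0 nothing  nothing  = ≤-refl
  Xᵍ≥0 nothing  (just _) = nonNegative⁻¹ 1ℚ
  Xᵍ≥0 (just _) nothing  = ≤-refl
  Xᵍ≥0 (just (i , u)) (just (j , v)) with i Fin.≟ j
  ... | yes refl = InSTT-Properties.X≥0 (P∈ i) u v
  ... | no  _    = precedes≥0 i j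

  Zᵍ≥0 : ∀ k x y → 0ℚ ≤ Zᵍ k x y
  Zᵍ≥0 (just (i , k)) (just (j , u)) (just (l , v)) with i Fin.≟ j | i Fin.≟ l
  ... | yes refl | yes refl = InSTT-Properties.Z≥0 (P∈ i) k u v
  ... | yes refl | no _     = ≤-refl
  ... | no _     | _        = ≤-refl
  Zᵍ≥0 nothing  _        _        = ≤-refl
  Zᵍ≥0 (just _) nothing  _        = ≤-refl
  Zᵍ≥0 (just _) (just _) nothing  = ≤-refl

  Zᵍ-dummy : ∀ k x y → ¬ Between G x y k → Zᵍ k x y ≡ 0ℚ
  Zᵍ-dummy (just (i , k)) (just (j , u)) (just (l , v)) k∉ with i Fin.≟ j | i Fin.≟ l
  ... | yes refl | yes refl = InSTT.Z-dummy (P∈ i) k u v (λ k∈ → k∉ (Between-map (ι i) inside ι-injectiveʳ k∈))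
  ... | yes refl | no _     = refl
  ... | no _     | _        = refl
  Zᵍ-dummy nothing  _        _       k∉ = refl
  Zᵍ-dummy (just _) nothing  _       k∉ = refl
  Zᵍ-dummy (just _) (just _) nothing k∉ = refl

  Zᵍ-sym : ∀ k x y → Zᵍ k x y ≡ Zᵍ k y x
  Zᵍ-sym (just (i , k)) (just (j , u)) (just (l , v)) with i Fin.≟ j | i Fin.≟ l
  ... | yes refl | yes refl = InSTT.Z-sym (P∈ i) k u v
  ... | yes refl | no _     = refl
  ... | no _     | yes refl = refl
  ... | no _     | no _     = refl
  Zᵍ-sym nothing  _        _        = refl
  Zᵍ-sym (just _) nothing  nothing  = refl
  Zᵍ-sym (just _) nothing  (just _) = refl
  Zᵍ-sym (just _) (just _) nothing  = refl

  Zᵍ≤Xᵍᵢ : ∀ k x y → Zᵍ k x y ≤ Xᵍ k x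
  Zᵍ≤Xᵍᵢ (just (i , k)) (just (j , u)) (just (l , v)) with i Fin.≟ j | i Fin.≟ l
  ... | yes refl | yes refl = InSTT-Properties.Z≤Xᵢ (P∈ i) k u v
  ... | yes refl | no _     = InSTT-Properties.X≥0 (P∈ i) k u
  ... | no _     | _        = precedes≥0 i j
  Zᵍ≤Xᵍᵢ nothing  x        y       = Xᵍ≥0 nothing x
  Zᵍ≤Xᵍᵢ (just a) nothing  y       = Xᵍ≥0 (just a) nothing
  Zᵍ≤Xᵍᵢ (just a) (just a') nothing = Xᵍ≥0 (just a) (just a')

  Zᵍ≤Xᵍⱼ : ∀ k x y → Zᵍ k x y ≤ Xᵍ k y
  Zᵍ≤Xᵍⱼ (just (i , k)) (just (j , u)) (just (l , v)) with i Fin.≟ j | i Fin.≟ l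
  ... | yes refl | yes refl = InSTT-Properties.Z≤Xⱼ (P∈ i) k u v
  ... | yes refl | no _     = precedes≥0 i l
  ... | no _     | yes refl = InSTT-Properties.X≥0 (P∈ i) k v
  ... | no _     | no _     = precedes≥0 i l
  Zᵍ≤Xᵍⱼ nothing  x        y       = Xᵍ≥0 nothing y
  Zᵍ≤Xᵍⱼ (just a) nothing  y       = Xᵍ≥0 (just a) y
  Zᵍ≤Xᵍⱼ (just a) (just a') nothing = Xᵍ≥0 (just a) nothing

  cover-sum : Node → Node → ℚ
  cover-sum x y = Xᵍ x y + Xᵍ y x + sumℚ nodes (λ k → Zᵍ k x y)

  cover-first : ∀ x y → Xᵍ x y ≡ 1ℚ → 1ℚ ≤ cover-sum x y
  cover-first x y x≺y = subst (λ a → 1ℚ ≤ a + Xᵍ y x + sumℚ nodes (λ k → Zᵍ k x y)) (sym x≺y)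
    (+-mono-≤ (+-monoʳ-≤ 1ℚ (Xᵍ≥0 y x)) (sumℚ-nonneg nodes (λ k → Zᵍ≥0 k x y)))

  cover-second : ∀ x y → Xᵍ y x ≡ 1ℚ → 1ℚ ≤ cover-sum x y
  cover-second x y y≺x = subst (λ a → 1ℚ ≤ Xᵍ x y + a + sumℚ nodes (λ k → Zᵍ k x y)) (sym y≺x)
    (+-mono-≤ (subst (_≤ Xᵍ x y + 1ℚ) (+-identityˡ 1ℚ) (+-monoˡ-≤ 1ℚ (Xᵍ≥0 x y))) (sumℚ-nonneg nodes (λ k → Zᵍ≥0 k x y)))

  sumℚ-Zᵍ-inside : ∀ i u v → sumℚ nodes (λ k → Zᵍ k (ι i u) (ι i v)) ≡ sumℚ (allFin (n i)) (λ k → Z (P i) k u v)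
  sumℚ-Zᵍ-inside i u v =
    trans (sumℚ-genum-subtree i (λ k → Zᵍ k (ι i u) (ι i v)) refl (λ j k j≢i → Zᵍ-elsewhere k u v (inj₁ j≢i)))
          (sumℚ-cong (allFin (n i)) (λ k → Zᵍ-inside i k u v))

  cover-inside : ∀ i {u v} → u ≢ v → 1ℚ ≤ cover-sum (ι i u) (ι i v)
  cover-inside i {u} {v} u≢v = subst (1ℚ ≤_) (sym cover-sum≡) (InSTT.cover (P∈ i) u v u≢v)
    where
    cover-sum≡ = cong₂ _+_ (cong₂ _+_ (Xᵍ-inside i u v) (Xᵍ-inside i v u)) (sumℚ-Zᵍ-inside i u v)

  cover-across : ∀ {i j} u v → i ≢ j → 1ℚ ≤ cover-sum (ι i u) (ι j v)
  cover-across u v i≢j with precedes-antisym i≢j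
  ... | inj₁ (i≺j , _) = cover-first (ι _ u) (ι _ v) (trans (Xᵍ-across u v i≢j) i≺j)
  ... | inj₂ (_ , j≺i) = cover-second (ι _ u) (ι _ v) (trans (Xᵍ-across v u (λ j≡i → i≢j (sym j≡i))) j≺i)

  cover-glued : ∀ x y → x ≢ y → 1ℚ ≤ cover-sum x y
  cover-glued nothing  nothing  x≢y = ⊥-elim (x≢y refl)
  cover-glued nothing  (just a) _   = cover-first nothing (just a) refl
  cover-glued (just a) nothing  _   = cover-second (just a) nothing refl
  cover-glued (just (i , u)) (just (j , v)) x≢y = by-subtrees (i Fin.≟ j)
    where
    by-subtrees : Dec (i ≡ j) → 1ℚ ≤ cover-sum (ι i u) (ι j v)
    by-subtrees (yes refl) = cover-inside i (λ u≡v → x≢y (cong (ι i) u≡v))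
    by-subtrees (no  i≢j)  = cover-across u v i≢j

  glued∈STT : InSTT G nodes glued
  glued∈STT = record
    { X-diag   = λ { nothing → refl ; (just (i , u)) → trans (Xᵍ-inside i u u) (InSTT.X-diag (P∈ i) u) }
    ; Z-dummy  = Zᵍ-dummy
    ; Z-sym    = Zᵍ-sym
    ; X-nonneg = λ x y _ → Xᵍ≥0 x y
    ; Z-nonneg = λ k x y _ → Zᵍ≥0 k x y
    ; cover    = cover-glued
    ; Z≤Xi     = λ k x y _ → Zᵍ≤Xᵍᵢ k x y
    ; Z≤Xj     = λ k x y _ → Zᵍ≤Xᵍⱼ k x y
    ; D-bound  = λ x → ≤-refl
    }

  column : Point Node → (i : Fin b) → Fin (n i) → ℚ
  column q i u = sumℚ (allFin (n i)) (λ j → X q (ι i j) (ι i u))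

  -- Shifting D by half the difference of the column sums keeps the D-bound
  -- of the restriction while the shifts of q and s cancel in their average.
  restrict : Point Node → Point Node → (i : Fin b) → Point (Fin (n i))
  restrict q s i = point (λ u → D (P i) u + ½ * (column q i u + - column s i u))
                         (λ u v → X q (ι i u) (ι i v))
                         (λ k u v → Z q (ι i k) (ι i u) (ι i v))

  module Restriction {q s : Point Node} (q∈ : InSTT G nodes q) (s∈ : InSTT G nodes s)
                     (mid : Midpoint glued q s) (i : Fin b) where
    open Midpoint-Properties q∈ s∈ mid
    private
      module Q = InSTT-Properties q∈
      X-mid = proj₁ (proj₂ mid)
      Z-mid = proj₂ (proj₂ mid)

    column-midpoint : ∀ u → sumℚ (allFin (n i)) (λ j → X (P i) j u) ≡ ½ * (column q i u + column s i u)
    column-midpoint u =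
      trans (sumℚ-cong (allFin (n i)) (λ j → trans (sym (Xᵍ-inside i j u)) (X-mid (ι i j) (ι i u))))
            (sumℚ-linear (allFin (n i)) ½ (λ j → X q (ι i j) (ι i u)) (λ j → X s (ι i j) (ι i u)))

    sumℚ-Z-inside : ∀ u v → sumℚ nodes (λ k → Z q k (ι i u) (ι i v)) ≡ sumℚ (allFin (n i)) (λ k → Z q (ι i k) (ι i u) (ι i v))
    sumℚ-Z-inside u v = sumℚ-genum-subtree i (λ k → Z q k (ι i u) (ι i v)) (proj₁ (Z-zero refl))
                          (λ j k j≢i → proj₁ (Z-zero (Zᵍ-elsewhere k u v (inj₁ j≢i))))

    D-bound : ∀ u → column q i u ≤ D (P i) u + ½ * (column q i u + - column s i u)
    D-bound u = begin
      cq                                                ≡⟨ solve 2 (λ a b → a := con ½ :* (a :+ b) :+ con ½ :* (a :+ :- b)) refl cq cs ⟩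
      ½ * (cq + cs) + ½ * (cq + - cs)                   ≡⟨ cong (_+ ½ * (cq + - cs)) (sym (column-midpoint u)) ⟩
      sumℚ (allFin (n i)) (λ j → X (P i) j u) + ½ * (cq + - cs) ≤⟨ +-monoˡ-≤ (½ * (cq + - cs)) (InSTT.D-bound (P∈ i) u) ⟩
      D (P i) u + ½ * (cq + - cs)                       ∎
      where
      open ≤-Reasoning
      cq = column q i u
      cs = column s i u

    restrict∈STT : InSTT (E i) (allFin (n i)) (restrict q s i)
    restrict∈STT = record
      { X-diag   = λ u → InSTT.X-diag q∈ (ι i u)
      ; Z-dummy  = λ k u v k∉ → proj₁ (Z-zero (trans (Zᵍ-inside i k u v) (InSTT.Z-dummy (P∈ i) k u v k∉)))
      ; Z-sym    = λ k u v → InSTT.Z-sym q∈ (ι i k) (ι i u) (ι i v)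
      ; X-nonneg = λ u v _ → Q.X≥0 (ι i u) (ι i v)
      ; Z-nonneg = λ k u v _ → Q.Z≥0 (ι i k) (ι i u) (ι i v)
      ; cover    = λ u v u≢v → subst (λ t → 1ℚ ≤ X q (ι i u) (ι i v) + X q (ι i v) (ι i u) + t)
                                     (sumℚ-Z-inside u v)
                                     (InSTT.cover q∈ (ι i u) (ι i v) (λ eq → u≢v (ι-injectiveʳ eq)))
      ; Z≤Xi     = λ k u v _ → Q.Z≤Xᵢ (ι i k) (ι i u) (ι i v)
      ; Z≤Xj     = λ k u v _ → Q.Z≤Xⱼ (ι i k) (ι i u) (ι i v)
      ; D-bound  = D-bound
      }

    restrict-midpoint : Midpoint (P i) (restrict q s i) (restrict s q i)
    restrict-midpoint =
      (λ u → solve 3 (λ d a b → d := con ½ :* ((d :+ con ½ :* (a :+ :- b)) :+ (d :+ con ½ :* (b :+ :- a))))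
                     refl (D (P i) u) (column q i u) (column s i u)) ,
      (λ u v → trans (sym (Xᵍ-inside i u v)) (X-mid (ι i u) (ι i v))) ,
      (λ k u v → trans (sym (Zᵍ-inside i k u v)) (Z-mid (ι i k) (ι i u) (ι i v)))

  module Decomposition {q s : Point Node} (q∈ : InSTT G nodes q) (s∈ : InSTT G nodes s)
                       (mid : Midpoint glued q s) where
    open Midpoint-Properties q∈ s∈ mid

    restrictions-agree : ∀ i → SamePoint (restrict q s i) (restrict s q i)
    restrictions-agree i =
      proj₂ (P-vertex i) (restrict q s i) (restrict s q i)
        (Restriction.restrict∈STT q∈ s∈ mid i)
        (Restriction.restrict∈STT s∈ q∈ (Midpoint-swap {q = q} {s} mid) i)
        (Restriction.restrict-midpoint q∈ s∈ mid i)

    X-agree-across : ∀ {i j} u v → i ≢ j → X q (ι i u) (ι j v) ≡ X s (ι i u) (ι j v)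
    X-agree-across u v i≢j with precedes-antisym i≢j
    ... | inj₁ (i≺j , j⊀i) =
      both-≡⇒≡ (X-one (λ eq → i≢j (ι-injectiveˡ eq)) (trans (Xᵍ-across u v i≢j) i≺j)
                      (trans (Xᵍ-across v u (λ j≡i → i≢j (sym j≡i))) j⊀i) (Zᵍ-across u v i≢j))
    ... | inj₂ (i⊀j , _) = both-≡⇒≡ (X-zero (trans (Xᵍ-across u v i≢j) i⊀j))

    X-agree : ∀ x y → X q x y ≡ X s x y
    X-agree nothing  nothing  = both-≡⇒≡ (X-zero refl)
    X-agree (just _) nothing  = both-≡⇒≡ (X-zero refl)
    X-agree nothing  (just _) = both-≡⇒≡ (X-one (λ ()) refl refl (λ { nothing → refl ; (just _) → refl }))
    X-agree (just (i , u)) (just (j , v)) with i Fin.≟ j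
    ... | yes refl = proj₁ (proj₂ (restrictions-agree i)) u v
    ... | no  i≢j  = X-agree-across u v i≢j

    Z-agree : ∀ k x y → Z q k x y ≡ Z s k x y
    Z-agree (just (i , k)) (just (j , u)) (just (l , v)) with i Fin.≟ j | i Fin.≟ l
    ... | yes refl | yes refl = proj₂ (proj₂ (restrictions-agree i)) k u v
    ... | no  i≢j  | _        = both-≡⇒≡ (Z-zero (Zᵍ-elsewhere k u v (inj₁ i≢j)))
    ... | yes _    | no  i≢l  = both-≡⇒≡ (Z-zero (Zᵍ-elsewhere k u v (inj₂ i≢l)))
    Z-agree nothing  _        _       = both-≡⇒≡ (Z-zero refl)
    Z-agree (just _) nothing  _       = both-≡⇒≡ (Z-zero refl)
    Z-agree (just _) (just _) nothing = both-≡⇒≡ (Z-zero refl)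

    D-agree : ∀ x → D q x ≡ D s x
    D-agree x = D-tight x refl (λ j → X-agree j x)

  glued-vertex : IsVertex G nodes glued
  glued-vertex = glued∈STT , λ q s q∈ s∈ mid →
    let open Decomposition q∈ s∈ mid in D-agree , X-agree , Z-agree

theorem3p14 : (b : ℕ) → b ≥ 2 →
    (n : Fin b → ℕ) →
    (E : (i : Fin b) → Fin (n i) → Fin (n i) → Set) →
    (∀ i → IsTree (E i)) →
    (c : (i : Fin b) → Fin (n i)) →
    (P : (i : Fin b) → Point (Fin (n i))) →
    (∀ i → IsVertex (E i) (allFin (n i)) (P i)) →
    ∃ λ (Q : Point (GNode b n)) →
      IsVertex (GEdge b n E c) (genum b n) Q ×
      (∀ i u v → X Q (just (i , u)) (just (i , v)) ≡ X (P i) u v) ×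
      (∀ i k u v → Z Q (just (i , k)) (just (i , u)) (just (i , v)) ≡ Z (P i) k u v)
theorem3p14 b _ n E _ c P P-vertex = glued , glued-vertex , Xᵍ-inside , Zᵍ-inside
  where open Gluing b n E c P P-vertex
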